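{- Let $b\ge 2$ and $N\ge1$ be integers with $\gcd(N,b)=1$. Let $d_1,d_2$ be divisors of $|b|_N$ with $d_1\mid d_2$. If $d_1\in\mathcal{M}_b(N)$, then $d_2\in\mathcal{M}_b(N)$.
   Context: $|b|_N$ denotes the multiplicative order of $b$ modulo $N$ (defined whenever $\gcd(N,b)=1$), and $\mathbb{U}_N=\{x: 1\le x<N,\ \gcd(x,N)=1\}$. Midy's set: for an integer $d\ge 2$ dividing $|b|_N$, put $L=|b|_N$ and $k=L/d$. For $x\in\mathbb{U}_N$, let $a_1a_2\cdots a_L$ be the base-$b$ digits (padded with leading zeros to exactly $L$ digits) of the integer $x(b^L-1)/N$; this is the period of the base-$b$ expansion of $x/N$. For $j=1,\dots,d$ let $A_j=[a_{(j-1)k+1}a_{(j-1)k+2}\cdots a_{jk}]_b$ be the integer whose base-$b$ digits are the $j$-th block of length $k$, and $S_d(x)=\sum_{j=1}^d A_j$. $N$ has the Midy property for $b$ and $d$ if $b^k-1$ divides $S_d(x)$ for every $x\in\mathbb{U}_N$. The Midy set $\mathcal{M}_b(N)$ is the set of integers $d\ge2$ dividing $|b|_N$ such that $N$ has the Midy property for $b$ and $d$. -}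

module Defs where

open import Data.Nat using (ℕ; zero; suc; _+_; _*_; _∸_; _^_; _≤_; _<_; NonZero)
open import Data.Nat.Properties using (m^n≢0)
open import Data.Nat.DivMod using (_/_; _%_)
open import Data.Nat.Divisibility using (_∣_)
open import Data.Nat.Coprimality using (Coprime)
open import Data.Product using (_×_)
open import Relation.Nullary using (¬_)
open import Relation.Binary.PropositionalEquality using (_≡_)

sum1 : ℕ → (ℕ → ℕ) → ℕ
sum1 zero    f = 0
sum1 (suc n) f = sum1 n f + f (suc n)

IsOrder : ℕ → ℕ → ℕ → Set
IsOrder b N L =
  1 ≤ L × N ∣ (b ^ L ∸ 1) × (∀ m → 1 ≤ m → m < L → ¬ (N ∣ (b ^ m ∸ 1)))

-- i-th base-b digit (i = 1 .. L, most significant first) of y padded to L digits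
digit : (b L y i : ℕ) → .{{NonZero b}} → ℕ
digit b L y i = (_/_ y (b ^ (L ∸ i)) ⦃ m^n≢0 b (L ∸ i) ⦄) % b

block : (b L k y j : ℕ) → .{{NonZero b}} → ℕ
block b L k y j = sum1 k (λ t → digit b L y ((j ∸ 1) * k + t) * b ^ (k ∸ t))

-- S_d(x) for the period y = x (b^L - 1) / N
Sd : (b L k d y : ℕ) → .{{NonZero b}} → ℕ
Sd b L k d y = sum1 d (λ j → block b L k y j)

MidyProperty : (b N L d : ℕ) → .{{NonZero b}} → .{{NonZero N}} → Set
MidyProperty b N L d =
  ∀ k → k * d ≡ L →
  ∀ x → 1 ≤ x → x < N → Coprime x N →
  (b ^ k ∸ 1) ∣ Sd b L k d ((x * (b ^ L ∸ 1)) / N)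

InMidySet : (b N L d : ℕ) → .{{NonZero b}} → .{{NonZero N}} → Set
InMidySet b N L d = 2 ≤ d × d ∣ L × MidyProperty b N L d

module Submission where

-- Write L = k·d₂ and d₂ = q·d₁, so that the d₁-blocks of the period
-- have length q·k and each of them is the concatenation of q consecutive
-- d₂-blocks of length k.  Positionally, a block of length q·k equals
-- Σ_i (b^k)^(q-i) · (its i-th sub-block of length k), and b^k ≡ 1 modulo
-- M = b^k - 1; hence every d₁-block is congruent modulo M to the sum of its
-- q sub-blocks, and summing over all blocks gives S_{d₂}(x) ≡ S_{d₁}(x)
-- (mod M).  Since M = b^k - 1 divides b^(q·k) - 1, which divides S_{d₁}(x)
-- by hypothesis, M divides S_{d₂}(x).

open import Defs
open import Data.Nat
  using (ℕ; zero; suc; _+_; _*_; _∸_; _^_; _≤_; z≤n; s≤s; NonZero; ≢-nonZero; >-nonZero)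
open import Data.Nat.Properties
open import Data.Nat.DivMod using (_/_; _%_; %-distribˡ-+; [m+kn]%n≡m%n)
open import Data.Nat.Divisibility
  using (_∣_; divides; ∣-refl; ∣-trans; ∣m∣n⇒∣m+n; ∣n⇒∣m*n; ∣⇒≤; m%n≡0⇒n∣m; n∣m⇒m%n≡0)
open import Data.Nat.Coprimality using (Coprime)
open import Data.Nat.Tactic.RingSolver using (solve-∀)
open import Data.Product using (_,_)
open import Relation.Binary.PropositionalEquality


sum1-cong : ∀ n (F G : ℕ → ℕ) → (∀ t → 1 ≤ t → t ≤ n → F t ≡ G t) →
  sum1 n F ≡ sum1 n G
sum1-cong zero    F G h = refl
sum1-cong (suc n) F G h =
  cong₂ _+_ (sum1-cong n F G (λ t 1≤t t≤n → h t 1≤t (m≤n⇒m≤1+n t≤n)))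
            (h (suc n) (s≤s z≤n) ≤-refl)

sum1-cong-mod : ∀ n M .{{_ : NonZero M}} (F G : ℕ → ℕ) →
  (∀ t → 1 ≤ t → t ≤ n → F t % M ≡ G t % M) → sum1 n F % M ≡ sum1 n G % M
sum1-cong-mod zero    M F G h = refl
sum1-cong-mod (suc n) M F G h = begin
    (sum1 n F + F (suc n)) % M
  ≡⟨ %-distribˡ-+ (sum1 n F) (F (suc n)) M ⟩
    (sum1 n F % M + F (suc n) % M) % M
  ≡⟨ cong₂ (λ u v → (u + v) % M)
       (sum1-cong-mod n M F G (λ t 1≤t t≤n → h t 1≤t (m≤n⇒m≤1+n t≤n)))
       (h (suc n) (s≤s z≤n) ≤-refl) ⟩
    (sum1 n G % M + G (suc n) % M) % M
  ≡⟨ %-distribˡ-+ (sum1 n G) (G (suc n)) M ⟨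
    (sum1 n G + G (suc n)) % M ∎
  where open ≡-Reasoning

sum1-*ˡ : ∀ n c (F : ℕ → ℕ) → sum1 n (λ t → c * F t) ≡ c * sum1 n F
sum1-*ˡ zero    c F = sym (*-zeroʳ c)
sum1-*ˡ (suc n) c F = begin
    sum1 n (λ t → c * F t) + c * F (suc n)
  ≡⟨ cong (_+ c * F (suc n)) (sum1-*ˡ n c F) ⟩
    c * sum1 n F + c * F (suc n)
  ≡⟨ *-distribˡ-+ c (sum1 n F) (F (suc n)) ⟨
    c * (sum1 n F + F (suc n)) ∎
  where open ≡-Reasoning

sum1-+ : ∀ n k (F : ℕ → ℕ) → sum1 (n + k) F ≡ sum1 n F + sum1 k (λ t → F (n + t))
sum1-+ n zero    F = trans (cong (λ m → sum1 m F) (+-identityʳ n)) (sym (+-identityʳ _))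
sum1-+ n (suc k) F = begin
    sum1 (n + suc k) F
  ≡⟨ cong (λ m → sum1 m F) (+-suc n k) ⟩
    sum1 (n + k) F + F (suc (n + k))
  ≡⟨ cong₂ _+_ (sum1-+ n k F) (cong F (sym (+-suc n k))) ⟩
    sum1 n F + sum1 k (λ t → F (n + t)) + F (n + suc k)
  ≡⟨ +-assoc (sum1 n F) _ _ ⟩
    sum1 n F + (sum1 k (λ t → F (n + t)) + F (n + suc k)) ∎
  where open ≡-Reasoning

sum1-blocks : ∀ m k (F : ℕ → ℕ) →
  sum1 (m * k) F ≡ sum1 m (λ i → sum1 k (λ t → F ((i ∸ 1) * k + t)))
sum1-blocks zero    k F = refl
sum1-blocks (suc m) k F = begin
    sum1 (k + m * k) F
  ≡⟨ cong (λ n → sum1 n F) (+-comm k (m * k)) ⟩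
    sum1 (m * k + k) F
  ≡⟨ sum1-+ (m * k) k F ⟩
    sum1 (m * k) F + sum1 k (λ t → F (m * k + t))
  ≡⟨ cong (_+ sum1 k (λ t → F (m * k + t))) (sum1-blocks m k F) ⟩
    sum1 m (λ i → sum1 k (λ t → F ((i ∸ 1) * k + t))) + sum1 k (λ t → F (m * k + t)) ∎
  where open ≡-Reasoning


*-pow-suc-mod : ∀ M .{{_ : NonZero M}} y r → (y * suc M ^ r) % M ≡ y % M
*-pow-suc-mod M y zero    = cong (_% M) (*-identityʳ y)
*-pow-suc-mod M y (suc r) = begin
    (y * (suc M * suc M ^ r)) % M
  ≡⟨ cong (_% M) (*-assoc y (suc M) _) ⟨
    (y * suc M * suc M ^ r) % M
  ≡⟨ *-pow-suc-mod M (y * suc M) r ⟩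
    (y * suc M) % M
  ≡⟨ cong (_% M) (*-suc y M) ⟩
    (y + y * M) % M
  ≡⟨ [m+kn]%n≡m%n y y M ⟩
    y % M ∎
  where open ≡-Reasoning

∣-pow-suc-∸1 : ∀ M q → M ∣ suc M ^ q ∸ 1
∣-pow-suc-∸1 M zero = divides 0 refl
∣-pow-suc-∸1 M (suc q) with suc M ^ q | ∣-pow-suc-∸1 M q | m^n>0 (suc M) q
... | suc c | M∣c | _ = subst (M ∣_) (step M c) (∣m∣n⇒∣m+n (∣n⇒∣m*n (suc M) M∣c) (∣-refl {M}))
  where
  -- (M+1)·(c+1) - 1 = (M+1)·c + M
  step : ∀ M c → suc M * c + M ≡ c + M * suc c
  step = solve-∀


-- The j-th block of length k of a digit sequence g, read in base b;
-- `block b L k y j` is `digitBlock b (digit b L y) k j` by definition.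
digitBlock : ℕ → (ℕ → ℕ) → ℕ → ℕ → ℕ
digitBlock b g k j = sum1 k (λ t → g ((j ∸ 1) * k + t) * b ^ (k ∸ t))

-- The digit at position t of sub-block i of block j (length q·k) is the
-- digit at position t of block (j-1)·q + i (length k).
subblock-index : ∀ a q k i t → 1 ≤ i →
  a * (q * k) + ((i ∸ 1) * k + t) ≡ (a * q + i ∸ 1) * k + t
subblock-index a q k (suc i) t _ = begin
    a * (q * k) + (i * k + t)
  ≡⟨ reorder a q k i t ⟩
    (a * q + i) * k + t
  ≡⟨ cong (λ n → (n ∸ 1) * k + t) (+-suc (a * q) i) ⟨
    (a * q + suc i ∸ 1) * k + t ∎
  where
  open ≡-Reasoning
  reorder : ∀ a q k i t → a * (q * k) + (i * k + t) ≡ (a * q + i) * k + t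
  reorder = solve-∀

-- The place value of position t of sub-block i factors as
-- (b^k)^(q-i) · b^(k-t).
subblock-weight : ∀ b q k i t → 1 ≤ i → i ≤ q → t ≤ k →
  b ^ (q * k ∸ ((i ∸ 1) * k + t)) ≡ (b ^ k) ^ (q ∸ i) * b ^ (k ∸ t)
subblock-weight b q k (suc i) t _ i≤q t≤k
  with m≤n⇒∃[o]m+o≡n i≤q | m≤n⇒∃[o]m+o≡n t≤k
... | r , refl | s , refl = begin
    b ^ ((suc i + r) * (t + s) ∸ (i * (t + s) + t))
  ≡⟨ cong (λ e → b ^ (e ∸ (i * (t + s) + t))) (split i r t s) ⟩
    b ^ ((i * (t + s) + t) + ((t + s) * r + s) ∸ (i * (t + s) + t))
  ≡⟨ cong (b ^_) (m+n∸m≡n (i * (t + s) + t) _) ⟩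
    b ^ ((t + s) * r + s)
  ≡⟨ ^-distribˡ-+-* b ((t + s) * r) s ⟩
    b ^ ((t + s) * r) * b ^ s
  ≡⟨ cong₂ (λ e f → e * b ^ f) (^-*-assoc b (t + s) r) (m+n∸m≡n t s) ⟨
    (b ^ (t + s)) ^ r * b ^ (t + s ∸ t)
  ≡⟨ cong (λ e → (b ^ (t + s)) ^ e * b ^ (t + s ∸ t)) (m+n∸m≡n (suc i) r) ⟨
    (b ^ (t + s)) ^ (suc i + r ∸ suc i) * b ^ (t + s ∸ t) ∎
  where
  open ≡-Reasoning
  split : ∀ i r t s → (suc i + r) * (t + s) ≡ (i * (t + s) + t) + ((t + s) * r + s)
  split = solve-∀

digitBlock-decompose : ∀ b g q k j →
  digitBlock b g (q * k) j ≡
  sum1 q (λ i → (b ^ k) ^ (q ∸ i) * digitBlock b g k ((j ∸ 1) * q + i))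
digitBlock-decompose b g q k j = begin
    digitBlock b g (q * k) j
  ≡⟨ sum1-blocks q k _ ⟩
    sum1 q (λ i → sum1 k (λ t → g (a * (q * k) + ((i ∸ 1) * k + t))
                                 * b ^ (q * k ∸ ((i ∸ 1) * k + t))))
  ≡⟨ sum1-cong q _ _ (λ i 1≤i i≤q → begin
       sum1 k (λ t → g (a * (q * k) + ((i ∸ 1) * k + t)) * b ^ (q * k ∸ ((i ∸ 1) * k + t)))
     ≡⟨ sum1-cong k _ _ (λ t _ t≤k →
          cong₂ _*_ (cong g (subblock-index a q k i t 1≤i))
                    (subblock-weight b q k i t 1≤i i≤q t≤k)) ⟩
       sum1 k (λ t → g ((a * q + i ∸ 1) * k + t) * ((b ^ k) ^ (q ∸ i) * b ^ (k ∸ t)))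
     ≡⟨ sum1-cong k _ _ (λ t _ _ → *-comm (g ((a * q + i ∸ 1) * k + t)) _) ⟩
       sum1 k (λ t → (b ^ k) ^ (q ∸ i) * b ^ (k ∸ t) * g ((a * q + i ∸ 1) * k + t))
     ≡⟨ sum1-cong k _ _ (λ t _ _ → *-assoc ((b ^ k) ^ (q ∸ i)) _ _) ⟩
       sum1 k (λ t → (b ^ k) ^ (q ∸ i) * (b ^ (k ∸ t) * g ((a * q + i ∸ 1) * k + t)))
     ≡⟨ sum1-*ˡ k ((b ^ k) ^ (q ∸ i)) _ ⟩
       (b ^ k) ^ (q ∸ i) * sum1 k (λ t → b ^ (k ∸ t) * g ((a * q + i ∸ 1) * k + t))
     ≡⟨ cong ((b ^ k) ^ (q ∸ i) *_)
          (sum1-cong k _ _ (λ t _ _ → *-comm (b ^ (k ∸ t)) _)) ⟩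
       (b ^ k) ^ (q ∸ i) * digitBlock b g k (a * q + i) ∎) ⟩
    sum1 q (λ i → (b ^ k) ^ (q ∸ i) * digitBlock b g k (a * q + i)) ∎
  where
  open ≡-Reasoning
  a = j ∸ 1

digitBlock-mod : ∀ b g q k M .{{_ : NonZero M}} → b ^ k ≡ suc M → ∀ j →
  digitBlock b g (q * k) j % M ≡ sum1 q (λ i → digitBlock b g k ((j ∸ 1) * q + i)) % M
digitBlock-mod b g q k M bᵏ≡1+M j = begin
    digitBlock b g (q * k) j % M
  ≡⟨ cong (_% M) (digitBlock-decompose b g q k j) ⟩
    sum1 q (λ i → (b ^ k) ^ (q ∸ i) * X i) % M
  ≡⟨ sum1-cong-mod q M _ _ (λ i _ _ → begin
       ((b ^ k) ^ (q ∸ i) * X i) % M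
     ≡⟨ cong (λ c → (c ^ (q ∸ i) * X i) % M) bᵏ≡1+M ⟩
       (suc M ^ (q ∸ i) * X i) % M
     ≡⟨ cong (_% M) (*-comm (suc M ^ (q ∸ i)) (X i)) ⟩
       (X i * suc M ^ (q ∸ i)) % M
     ≡⟨ *-pow-suc-mod M (X i) (q ∸ i) ⟩
       X i % M ∎) ⟩
    sum1 q X % M ∎
  where
  open ≡-Reasoning
  X : ℕ → ℕ
  X i = digitBlock b g k ((j ∸ 1) * q + i)

Sd-refine-mod : ∀ b L k q d y .{{_ : NonZero b}} M .{{_ : NonZero M}} → b ^ k ≡ suc M →
  Sd b L k (q * d) y % M ≡ Sd b L (q * k) d y % M
Sd-refine-mod b L k q d y M bᵏ≡1+M = begin
    sum1 (q * d) (digitBlock b g k) % M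
  ≡⟨ cong (λ n → sum1 n (digitBlock b g k) % M) (*-comm q d) ⟩
    sum1 (d * q) (digitBlock b g k) % M
  ≡⟨ cong (_% M) (sum1-blocks d q (digitBlock b g k)) ⟩
    sum1 d (λ j → sum1 q (λ i → digitBlock b g k ((j ∸ 1) * q + i))) % M
  ≡⟨ sum1-cong-mod d M _ _ (λ j _ _ → digitBlock-mod b g q k M bᵏ≡1+M j) ⟨
    sum1 d (digitBlock b g (q * k)) % M ∎
  where
  open ≡-Reasoning
  g : ℕ → ℕ
  g i = digit b L y i


-- For b ≥ 2 and k ≥ 1, b^k ≥ 2, so that b^k - 1 is a nonzero modulus.
pow-≥2 : ∀ b k → 2 ≤ b → 1 ≤ k → 2 ≤ b ^ k
pow-≥2 b k 2≤b 1≤k = begin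
    2         ≤⟨ 2≤b ⟩
    b         ≡⟨ *-identityʳ b ⟨
    b ^ 1     ≤⟨ ^-monoʳ-≤ b {{>-nonZero (≤-trans (s≤s z≤n) 2≤b)}} 1≤k ⟩
    b ^ k     ∎
  where open ≤-Reasoning

-- If d has the Midy property (for any L ≥ 1) then so does q·d: blocks of
-- length k are sub-blocks of the blocks of length q·k.
midy-multiple : ∀ b N L .{{_ : NonZero b}} .{{_ : NonZero N}} → 2 ≤ b → 1 ≤ L →
  ∀ d q → MidyProperty b N L d → MidyProperty b N L (q * d)
midy-multiple b N L 2≤b 1≤L d q midy k kqd≡L x 1≤x x<N x⊥N =
  m%n≡0⇒n∣m _ M (begin
    Sd b L k (q * d) y % M       ≡⟨ Sd-refine-mod b L k q d y M bᵏ≡1+M ⟩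
    Sd b L (q * k) d y % M       ≡⟨ n∣m⇒m%n≡0 _ M (∣-trans M∣bᵠᵏ∸1 bᵠᵏ∸1∣S) ⟩
    0                            ∎)
  where
  open ≡-Reasoning
  y = (x * (b ^ L ∸ 1)) / N
  M = b ^ k ∸ 1
  1≤k : 1 ≤ k
  1≤k = n≢0⇒n>0 (λ k≡0 → <⇒≢ 1≤L (sym (trans (sym kqd≡L) (cong (_* (q * d)) k≡0))))
  instance
    M≢0 : NonZero M
    M≢0 = >-nonZero (∸-monoˡ-≤ 1 (pow-≥2 b k 2≤b 1≤k))
  bᵏ≡1+M : b ^ k ≡ suc M
  bᵏ≡1+M = sym (m+[n∸m]≡n (≤-trans (s≤s z≤n) (pow-≥2 b k 2≤b 1≤k)))
  qkd≡L : q * k * d ≡ L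
  qkd≡L = trans (reassoc q k d) kqd≡L
    where
    reassoc : ∀ q k d → q * k * d ≡ k * (q * d)
    reassoc = solve-∀
  bᵠᵏ∸1∣S : b ^ (q * k) ∸ 1 ∣ Sd b L (q * k) d y
  bᵠᵏ∸1∣S = midy (q * k) qkd≡L x 1≤x x<N x⊥N
  M∣bᵠᵏ∸1 : M ∣ b ^ (q * k) ∸ 1
  M∣bᵠᵏ∸1 = subst (λ c → M ∣ c ∸ 1)
    (trans (cong (_^ q) (sym bᵏ≡1+M)) (trans (^-*-assoc b k q) (cong (b ^_) (*-comm k q))))
    (∣-pow-suc-∸1 M q)

corollary2p2 : (b N : ℕ) → .{{_ : NonZero b}} → .{{_ : NonZero N}} →
    2 ≤ b → 1 ≤ N → Coprime N b →
    (L : ℕ) → IsOrder b N L →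
    (d₁ d₂ : ℕ) → d₁ ∣ L → d₂ ∣ L → d₁ ∣ d₂ →
    InMidySet b N L d₁ → InMidySet b N L d₂
corollary2p2 b N 2≤b _ _ L (1≤L , _ , _) d₁ d₂ _ d₂∣L@(divides p L≡pd₂) (divides q d₂≡qd₁)
             (2≤d₁ , _ , midy₁) =
  2≤d₂ , d₂∣L , subst (λ d → MidyProperty b N L d) (sym d₂≡qd₁) (midy-multiple b N L 2≤b 1≤L d₁ q midy₁)
  where
  -- d₂ ≠ 0 because it divides L ≥ 1; then d₁ ∣ d₂ gives d₁ ≤ d₂.
  d₂≢0 : NonZero d₂
  d₂≢0 = ≢-nonZero λ d₂≡0 → <⇒≢ 1≤L (sym (trans L≡pd₂ (trans (cong (p *_) d₂≡0) (*-zeroʳ p))))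
  2≤d₂ : 2 ≤ d₂
  2≤d₂ = ≤-trans 2≤d₁ (∣⇒≤ {{d₂≢0}} (divides q d₂≡qd₁))
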